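{- For all $n \ge 20$, \[ \pi_{(n,n)}((1,1)) \le 2\max_{t\ge 0}\{P_t\}\cdot \sum_{t\ge 0} P_t, \] where $P_t = \Pr_{w\sim\mathcal{W}(1)}\big[w^{(t)} = n,\ \max_{0\le r\le t} w^{(r)} = n,\ \min_{0\le r\le t} w^{(r)}\ge 1\big]$.
   Context: The graph $\square_n$ has vertex set $\{1,\dots,n\}^2\cup\{s\}$, where $s$ is a sink. Non-sink vertices differing by $1$ in exactly one coordinate are adjacent. Boundary vertices have extra edges to $s$ so that every non-sink vertex has degree $4$. For non-sink vertices $u,v$, the potential $\pi_u(v)$ is the probability that the simple random walk on $\square_n$ started at $v$ hits $u$ before hitting $s$. Each step of this walk traverses a uniformly random one of the $4$ incident edges, counting multi-edges to $s$. Equivalently, $\pi_u(v)$ is the voltage at $v$ in the unit-resistor network with $u$ held at voltage $1$ and $s$ at voltage $0$. $\mathcal{W}(i)$ denotes a simple symmetric random walk $(w^{(0)},w^{(1)},\dots)$ on $\mathbb{Z}$ with $w^{(0)}=i$ and independent $\pm1$ steps, each with probability $1/2$. -}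

module Defs where

open import Data.Bool using (Bool; true; false; _∧_; if_then_else_)
open import Data.Nat as ℕ using (ℕ; zero; suc; _^_; _≤ᵇ_)
open import Data.Nat.Properties using (m^n≢0)
open import Data.Integer as ℤ using (ℤ; +_)
open import Data.List using (List; []; _∷_; map; _++_; length; filter; foldr; all)
open import Data.Rational as ℚ using (ℚ; 0ℚ)
open import Relation.Nullary.Decidable using (⌊_⌋)
open import Relation.Nullary using (¬_)
open import Relation.Binary.PropositionalEquality using (_≡_)
open import Data.Product using (_×_)

-- Random walk W(1) on ℤ: a run of length t is a list of t steps
-- (true = +1, false = -1); each of the 2^t lists has probability 2^-t.

allSteps : ℕ → List (List Bool)
allSteps zero    = [] ∷ []
allSteps (suc t) = map (true ∷_) (allSteps t) ++ map (false ∷_) (allSteps t)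

step : Bool → ℤ → ℤ
step true  x = x ℤ.+ ℤ.1ℤ
step false x = x ℤ.- ℤ.1ℤ

positions : ℤ → List Bool → List ℤ
positions x []       = x ∷ []
positions x (b ∷ bs) = x ∷ positions (step b x) bs

endpoint : ℤ → List Bool → ℤ
endpoint x []       = x
endpoint x (b ∷ bs) = endpoint (step b x) bs

maxPos : ℤ → List Bool → ℤ
maxPos x bs = foldr ℤ._⊔_ x (positions x bs)

minPos : ℤ → List Bool → ℤ
minPos x bs = foldr ℤ._⊓_ x (positions x bs)

event : ℕ → List Bool → Bool
event n bs = ⌊ endpoint (+ 1) bs ℤ.≟ + n ⌋
           ∧ ⌊ maxPos (+ 1) bs ℤ.≟ + n ⌋
           ∧ (ℤ.1ℤ ℤ.≤ᵇ minPos (+ 1) bs)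

count : ℕ → List (List Bool) → ℕ
count n []         = 0
count n (bs ∷ bss) = (if event n bs then 1 else 0) ℕ.+ count n bss

P : ℕ → ℕ → ℚ
P n t = (+ count n (allSteps t)) ℚ./ (2 ^ t)
  where instance _ = m^n≢0 2 t

Psum : ℕ → ℕ → ℚ
Psum n zero    = 0ℚ
Psum n (suc T) = Psum n T ℚ.+ P n T

-- A function h on vertices is encoded
-- as h : ℕ → ℕ → ℚ, of which only the values at (i,j) ∈ {1..n}² matter;
-- every position outside {1..n}² is the sink s, where the voltage is 0.
-- (Boundary vertices have their extra edges to s, so each such edge
-- contributes 0, exactly as a neighbour outside the box.)

inBox : ℕ → ℕ → Set
inBox n i = (1 ℕ.≤ i) × (i ℕ.≤ n)

val : ℕ → (ℕ → ℕ → ℚ) → ℕ → ℕ → ℚ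
val n h i j = if (1 ≤ᵇ i) ∧ (i ≤ᵇ n) ∧ (1 ≤ᵇ j) ∧ (j ≤ᵇ n) then h i j else 0ℚ

-- sum of voltages over the 4 incident edges of (i,j)   (i,j ≥ 1)
nbrSum : ℕ → (ℕ → ℕ → ℚ) → ℕ → ℕ → ℚ
nbrSum n h i j = val n h (suc i) j ℚ.+ val n h (i ℕ.∸ 1) j
               ℚ.+ val n h i (suc j) ℚ.+ val n h i (j ℕ.∸ 1)

IsPotential : ℕ → ℕ → ℕ → (ℕ → ℕ → ℚ) → Set
IsPotential n a b h =
  (h a b ≡ ℚ.1ℚ) ×
  (∀ i j → inBox n i → inBox n j → ¬ ((i ≡ a) × (j ≡ b)) →
     (+ 4 ℚ./ 1) ℚ.* h i j ≡ nbrSum n h i j)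

module Submission where

-- Let p i t be the probability that the walk from i stands at n after t steps, having stayed in
-- [1, n]; thus P t = p 1 t. The grid walk moves a uniformly chosen coordinate, so summing over t < T
-- the binomial mixtures of p i k · p j (t − k) gives a function F_T with
-- F_(T+1) = [(i, j) = (n, n)] + ¼ Σ_neighbours F_T on the box, while π = π_(n,n) is harmonic off
-- (n, n) with π (n, n) = 1. The product ψ of the discrete parabolas i (n + 1 − i) and j (n + 1 − j)
-- satisfies ¼ Σ_neighbours ψ ≤ (1 − 1/(2n²)) ψ, so induction on T gives
-- π ≤ F_T + B (1 − 1/(2n²))^T ψ for any bound B of π, and the error term is eventually below ε.
-- As Σ_m C(k + m, k) 2^−(k+m) = 2, the mixture sum is at most 2 max_t P_t · Σ_(t<T) P_t.
-- The maximum exists because the one-dimensional parabola gives P_t ≤ (1 − 1/n²)^t,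
-- while P_(n−1) ≥ 2^−(n−1).

open import Defs
open import Data.Nat using (ℕ) renaming (_≤_ to _≤ℕ_)
open import Data.Integer using (+_)
open import Data.Rational using (ℚ; _/_; _+_; _*_; _≤_; _<_; 0ℚ)
open import Data.Product using (Σ; ∃; _×_)

open import Algebra.Definitions using (Associative; Commutative; Idempotent)
open import Data.Bool using (Bool; true; false; _∧_; if_then_else_; T)
open import Data.Bool.Properties using (T-∧)
open import Data.Empty using (⊥-elim)
open import Data.Integer as ℤ using (ℤ; -[1+_])
import Data.Integer.Properties as ℤ
open import Data.List using (List; []; _∷_; map; _++_; foldr; upTo)
open import Data.List.Membership.Propositional.Properties using (∈-upTo⁺)
import Data.List.Relation.Unary.All as All
import Data.List.Extrema
open import Data.Nat as ℕ using (zero; suc; _∸_; z≤n; s≤s)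
import Data.Nat.Properties as ℕ
open import Data.Nat.Solver using () renaming (module +-*-Solver to ℕ-Solver)
open import Data.Product using (_,_; proj₁; proj₂)
open import Data.Product.Function.NonDependent.Propositional using (_×-⇔_)
open import Data.Rational as ℚ using (mkℚ; 1ℚ; ½; _⊔_)
import Data.Rational.Properties as ℚ
open import Data.Rational.Solver using () renaming (module +-*-Solver to ℚ-Solver)
open import Data.Rational.Unnormalised as ℚᵘ using (mkℚᵘ; *≡*; *≤*)
import Data.Rational.Unnormalised.Properties as ℚᵘ
open import Data.Sum using (inj₁; inj₂)
open import Data.Unit using (tt)
open import Algebra.Definitions.RawSemiring ℚ.+-*-rawSemiring using (_^_)
open import Function using (_⇔_; mk⇔; Equivalence; _$_)
import Function.Properties.Equivalence as ⇔
open import Relation.Binary.Bundles using (DecTotalOrder)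
open import Relation.Binary.PropositionalEquality
open import Relation.Nullary using (¬_; yes; no)
open import Relation.Nullary.Decidable using (⌊_⌋; toWitness; fromWitness; Dec; _×-dec_)

-- Walks on the segment [1, n]

T-⇔⇒≡ : ∀ {a b} → (T a ⇔ T b) → a ≡ b
T-⇔⇒≡ {false} {false} _ = refl
T-⇔⇒≡ {false} {true}  e = ⊥-elim (Equivalence.from e tt)
T-⇔⇒≡ {true}  {false} e = ⊥-elim (Equivalence.to e tt)
T-⇔⇒≡ {true}  {true}  _ = refl

module FoldrSemilattice {A : Set} (_∙_ : A → A → A) (assoc : Associative _≡_ _∙_)
  (comm : Commutative _≡_ _∙_) (idem : Idempotent _≡_ _∙_) where

  foldr-∙-init : ∀ a e xs → a ∙ foldr _∙_ e xs ≡ foldr _∙_ (a ∙ e) xs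
  foldr-∙-init a e [] = refl
  foldr-∙-init a e (y ∷ xs) = begin
    a ∙ (y ∙ foldr _∙_ e xs)   ≡⟨ sym (assoc a y _) ⟩
    (a ∙ y) ∙ foldr _∙_ e xs   ≡⟨ cong (_∙ foldr _∙_ e xs) (comm a y) ⟩
    (y ∙ a) ∙ foldr _∙_ e xs   ≡⟨ assoc y a _ ⟩
    y ∙ (a ∙ foldr _∙_ e xs)   ≡⟨ cong (y ∙_) (foldr-∙-init a e xs) ⟩
    y ∙ foldr _∙_ (a ∙ e) xs   ∎
    where open ≡-Reasoning

  foldr-∙-reinit : ∀ x y xs → x ∙ foldr _∙_ x (y ∷ xs) ≡ x ∙ foldr _∙_ y (y ∷ xs)
  foldr-∙-reinit x y xs = begin
    x ∙ (y ∙ foldr _∙_ x xs)   ≡⟨ cong (x ∙_) (foldr-∙-init y x xs) ⟩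
    x ∙ foldr _∙_ (y ∙ x) xs   ≡⟨ foldr-∙-init x (y ∙ x) xs ⟩
    foldr _∙_ (x ∙ (y ∙ x)) xs ≡⟨ cong (λ z → foldr _∙_ z xs) xyx≡xyy ⟩
    foldr _∙_ (x ∙ (y ∙ y)) xs ≡⟨ sym (foldr-∙-init x (y ∙ y) xs) ⟩
    x ∙ foldr _∙_ (y ∙ y) xs   ≡⟨ cong (x ∙_) (sym (foldr-∙-init y y xs)) ⟩
    x ∙ (y ∙ foldr _∙_ y xs)   ∎
    where
    open ≡-Reasoning
    xyx≡xyy : x ∙ (y ∙ x) ≡ x ∙ (y ∙ y)
    xyx≡xyy = begin
      x ∙ (y ∙ x) ≡⟨ cong (x ∙_) (comm y x) ⟩
      x ∙ (x ∙ y) ≡⟨ sym (assoc x x y) ⟩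
      (x ∙ x) ∙ y ≡⟨ cong (_∙ y) (idem x) ⟩
      x ∙ y       ≡⟨ cong (x ∙_) (sym (idem y)) ⟩
      x ∙ (y ∙ y) ∎

module Max = FoldrSemilattice ℤ._⊔_ ℤ.⊔-assoc ℤ.⊔-comm ℤ.⊔-idem
module Min = FoldrSemilattice ℤ._⊓_ ℤ.⊓-assoc ℤ.⊓-comm ℤ.⊓-idem

maxPos-∷ : ∀ x b bs → maxPos x (b ∷ bs) ≡ x ℤ.⊔ maxPos (step b x) bs
maxPos-∷ x b []       = Max.foldr-∙-reinit x (step b x) []
maxPos-∷ x b (c ∷ bs) = Max.foldr-∙-reinit x (step b x) (positions (step c (step b x)) bs)

minPos-∷ : ∀ x b bs → minPos x (b ∷ bs) ≡ x ℤ.⊓ minPos (step b x) bs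
minPos-∷ x b []       = Min.foldr-∙-reinit x (step b x) []
minPos-∷ x b (c ∷ bs) = Min.foldr-∙-reinit x (step b x) (positions (step c (step b x)) bs)

endpoint≤maxPos : ∀ x bs → endpoint x bs ℤ.≤ maxPos x bs
endpoint≤maxPos x []       = ℤ.i≤i⊔j x x
endpoint≤maxPos x (b ∷ bs) = subst (endpoint (step b x) bs ℤ.≤_) (sym (maxPos-∷ x b bs))
  (ℤ.≤-trans (endpoint≤maxPos (step b x) bs) (ℤ.i≤j⊔i x _))

eventFrom : ℕ → ℤ → List Bool → Bool
eventFrom n x bs = ⌊ endpoint x bs ℤ.≟ + n ⌋
                 ∧ ⌊ maxPos x bs ℤ.≟ + n ⌋
                 ∧ (ℤ.1ℤ ℤ.≤ᵇ minPos x bs)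

Hits : ℕ → ℤ → List Bool → Set
Hits n x bs = endpoint x bs ≡ + n × maxPos x bs ≡ + n × ℤ.1ℤ ℤ.≤ minPos x bs

inRange : ℕ → ℤ → Bool
inRange n x = (ℤ.1ℤ ℤ.≤ᵇ x) ∧ (x ℤ.≤ᵇ + n)

InRange : ℕ → ℤ → Set
InRange n x = ℤ.1ℤ ℤ.≤ x × x ℤ.≤ + n

T-≤ᵇ : ∀ {x y} → T (x ℤ.≤ᵇ y) ⇔ x ℤ.≤ y
T-≤ᵇ = mk⇔ ℤ.≤ᵇ⇒≤ ℤ.≤⇒≤ᵇ

T-≟ : ∀ {x y} → T ⌊ x ℤ.≟ y ⌋ ⇔ x ≡ y
T-≟ = mk⇔ toWitness fromWitness

T-eventFrom : ∀ n x bs → T (eventFrom n x bs) ⇔ Hits n x bs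
T-eventFrom n x bs = ⇔.trans T-∧ (T-≟ ×-⇔ ⇔.trans T-∧ (T-≟ ×-⇔ T-≤ᵇ))

T-inRange : ∀ {n x} → T (inRange n x) ⇔ InRange n x
T-inRange = ⇔.trans T-∧ (T-≤ᵇ ×-⇔ T-≤ᵇ)

Hits-∷ : ∀ n x b bs → Hits n x (b ∷ bs) ⇔ (InRange n x × Hits n (step b x) bs)
Hits-∷ n x b bs = mk⇔ to from
  where
  y = step b x
  M = maxPos y bs
  m = minPos y bs
  to : Hits n x (b ∷ bs) → InRange n x × Hits n y bs
  to (E≡n , max≡n , 1≤min) = (1≤x , x≤n) , E≡n , M≡n , 1≤m
    where
    x⊔M≡n = trans (sym (maxPos-∷ x b bs)) max≡n
    1≤x⊓m = subst (ℤ.1ℤ ℤ.≤_) (minPos-∷ x b bs) 1≤min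
    1≤x = ℤ.i≤j⊓k⇒i≤j x m 1≤x⊓m
    1≤m = ℤ.i≤j⊓k⇒i≤k x m 1≤x⊓m
    x≤n = subst (x ℤ.≤_) x⊔M≡n (ℤ.i≤i⊔j x M)
    M≡n = ℤ.≤-antisym (subst (M ℤ.≤_) x⊔M≡n (ℤ.i≤j⊔i x M))
                      (subst (ℤ._≤ M) E≡n (endpoint≤maxPos y bs))
  from : InRange n x × Hits n y bs → Hits n x (b ∷ bs)
  from ((1≤x , x≤n) , E≡n , M≡n , 1≤m) =
    E≡n ,
    trans (maxPos-∷ x b bs) (trans (cong (x ℤ.⊔_) M≡n) (ℤ.i≤j⇒i⊔j≡j x≤n)) ,
    subst (ℤ.1ℤ ℤ.≤_) (sym (minPos-∷ x b bs)) (ℤ.⊓-glb 1≤x 1≤m)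

eventFrom-∷ : ∀ n x b bs → eventFrom n x (b ∷ bs) ≡ inRange n x ∧ eventFrom n (step b x) bs
eventFrom-∷ n x b bs = T-⇔⇒≡ (⇔.trans (T-eventFrom n x (b ∷ bs)) (⇔.trans (Hits-∷ n x b bs)
  (⇔.sym (⇔.trans T-∧ (T-inRange ×-⇔ T-eventFrom n (step b x) bs)))))

if-T : ∀ {A : Set} {b} (x y : A) → T b → (if b then x else y) ≡ x
if-T {b = true} x y _ = refl

if-¬T : ∀ {A : Set} {b} (x y : A) → ¬ T b → (if b then x else y) ≡ y
if-¬T {b = true}  x y ¬t = ⊥-elim (¬t tt)
if-¬T {b = false} x y _  = refl

countFrom : ℕ → ℤ → List (List Bool) → ℕ
countFrom n x []         = 0
countFrom n x (bs ∷ bss) = (if eventFrom n x bs then 1 else 0) ℕ.+ countFrom n x bss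

count≡countFrom : ∀ n bss → count n bss ≡ countFrom n (+ 1) bss
count≡countFrom n []         = refl
count≡countFrom n (bs ∷ bss) = cong ((if event n bs then 1 else 0) ℕ.+_) (count≡countFrom n bss)

countFrom-++ : ∀ n x bss css → countFrom n x (bss ++ css) ≡ countFrom n x bss ℕ.+ countFrom n x css
countFrom-++ n x []         css = refl
countFrom-++ n x (bs ∷ bss) css =
  trans (cong ((if eventFrom n x bs then 1 else 0) ℕ.+_) (countFrom-++ n x bss css))
        (sym (ℕ.+-assoc (if eventFrom n x bs then 1 else 0) _ _))

countFrom-map-∷ : ∀ n x b bss →
  countFrom n x (map (b ∷_) bss) ≡ (if inRange n x then countFrom n (step b x) bss else 0)
countFrom-map-∷ n x b [] with inRange n x
... | true  = refl
... | false = refl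
countFrom-map-∷ n x b (bs ∷ bss)
  rewrite eventFrom-∷ n x b bs | countFrom-map-∷ n x b bss with inRange n x
... | true  = refl
... | false = refl

walks : ℕ → ℕ → ℕ → ℕ
walks n i t = countFrom n (+ i) (allSteps t)

T-inRange-+ : ∀ {n i} → T (inRange n (+ i)) ⇔ inBox n i
T-inRange-+ = ⇔.trans T-inRange (mk⇔ (λ (p , q) → ℤ.drop‿+≤+ p , ℤ.drop‿+≤+ q) (λ (p , q) → ℤ.+≤+ p , ℤ.+≤+ q))

walks-suc : ∀ n i t → walks n i (suc t) ≡
  (if inRange n (+ i) then countFrom n (step true (+ i)) (allSteps t) ℕ.+ countFrom n (step false (+ i)) (allSteps t) else 0)
walks-suc n i t
  rewrite countFrom-++ n (+ i) (map (true ∷_) (allSteps t)) (map (false ∷_) (allSteps t))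
        | countFrom-map-∷ n (+ i) true (allSteps t) | countFrom-map-∷ n (+ i) false (allSteps t)
  with inRange n (+ i)
... | true  = refl
... | false = refl

walks-suc-inBox : ∀ n i t → inBox n i → walks n i (suc t) ≡ walks n (suc i) t ℕ.+ walks n (i ∸ 1) t
walks-suc-inBox n (suc i) t box = begin
  walks n (suc i) (suc t)                                      ≡⟨ walks-suc n (suc i) t ⟩
  (if inRange n (+ suc i) then up ℕ.+ walks n i t else 0)      ≡⟨ if-T _ 0 (Equivalence.from T-inRange-+ box) ⟩
  up ℕ.+ walks n i t                                           ≡⟨ cong (λ x → countFrom n (+ x) (allSteps t) ℕ.+ walks n i t) (ℕ.+-comm (suc i) 1) ⟩
  walks n (suc (suc i)) t ℕ.+ walks n i t                      ∎
  where
  open ≡-Reasoning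
  up = countFrom n (+ suc i ℤ.+ ℤ.1ℤ) (allSteps t)

walks-suc-outBox : ∀ n i t → ¬ inBox n i → walks n i (suc t) ≡ 0
walks-suc-outBox n i t ¬box =
  trans (walks-suc n i t) (if-¬T _ 0 (λ t → ¬box (Equivalence.to T-inRange-+ t)))

walks-zero-≢ : ∀ n i → i ≢ n → walks n i 0 ≡ 0
walks-zero-≢ n i i≢n = trans (ℕ.+-identityʳ _) $
  if-¬T 1 0 (λ t → i≢n (ℤ.+-injective (proj₁ (Equivalence.to (T-eventFrom n (+ i) []) t))))

walks-zero-target : ∀ n → 1 ℕ.≤ n → walks n n 0 ≡ 1
walks-zero-target n 1≤n = trans (ℕ.+-identityʳ _) $ if-T 1 0 (Equivalence.from (T-eventFrom n (+ n) [])
  (refl , ℤ.⊔-idem (+ n) , subst (ℤ.1ℤ ℤ.≤_) (sym (ℤ.⊓-idem (+ n))) (ℤ.+≤+ 1≤n)))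

walks-outBox : ∀ n i t → 1 ℕ.≤ n → ¬ inBox n i → walks n i t ≡ 0
walks-outBox n i zero    1≤n ¬box = walks-zero-≢ n i (λ { refl → ¬box (1≤n , ℕ.≤-refl) })
walks-outBox n i (suc t) 1≤n ¬box = walks-suc-outBox n i t ¬box

walks-pos : ∀ n i k → 1 ℕ.≤ i → i ℕ.+ k ≡ n → 1 ℕ.≤ walks n i k
walks-pos n i zero    1≤i i+0≡n rewrite ℕ.+-identityʳ i | i+0≡n =
  ℕ.≤-reflexive (sym (walks-zero-target n 1≤i))
walks-pos n i (suc k) 1≤i refl
  rewrite walks-suc-inBox n i k (1≤i , ℕ.m≤m+n i (suc k)) =
  ℕ.≤-trans (walks-pos n (suc i) k (s≤s z≤n) (sym (ℕ.+-suc i k))) (ℕ.m≤m+n _ _)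

inBox? : ∀ n i → Dec (inBox n i)
inBox? n i = (1 ℕ.≤? i) ×-dec (i ℕ.≤? n)

-- Fractions of natural numbers

infixl 7 _/ₙ_

-- Opaque because unfolding the normalisation in ℚ division makes unification intractable.
opaque
  _/ₙ_ : ℕ → (d : ℕ) → .{{ℕ.NonZero d}} → ℚ
  a /ₙ d = + a / d

  /ₙ≡/ : ∀ a d .{{_ : ℕ.NonZero d}} → a /ₙ d ≡ + a / d
  /ₙ≡/ a d = refl

  ½≡1/ₙ2 : ½ ≡ 1 /ₙ 2
  ½≡1/ₙ2 = refl

  1/ₙ1≡1 : 1 /ₙ 1 ≡ 1ℚ
  1/ₙ1≡1 = refl

  0/ₙ1≡0 : 0 /ₙ 1 ≡ 0ℚ
  0/ₙ1≡0 = refl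

  suc/ₙ1-pos : ∀ k → ℚ.Positive (suc k /ₙ 1)
  suc/ₙ1-pos k = ℚ.normalize-pos (suc k) 1

  private
    toℚᵘ-/ₙ : ∀ a d → ℚ.toℚᵘ (a /ₙ suc d) ℚᵘ.≃ mkℚᵘ (+ a) d
    toℚᵘ-/ₙ a d = ℚ.toℚᵘ-fromℚᵘ (mkℚᵘ (+ a) d)

    mkℚᵘ-≃ : ∀ a c b d → a ℕ.* suc d ≡ c ℕ.* suc b → mkℚᵘ (+ a) b ℚᵘ.≃ mkℚᵘ (+ c) d
    mkℚᵘ-≃ a c b d e = *≡* (trans (sym (ℤ.pos-* a (suc d))) (trans (cong +_ e) (ℤ.pos-* c (suc b))))

    mkℚᵘ-≤ : ∀ a c b d → a ℕ.* suc d ℕ.≤ c ℕ.* suc b → mkℚᵘ (+ a) b ℚᵘ.≤ mkℚᵘ (+ c) d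
    mkℚᵘ-≤ a c b d le = *≤* (subst₂ ℤ._≤_ (ℤ.pos-* a (suc d)) (ℤ.pos-* c (suc b)) (ℤ.+≤+ le))

  /ₙ-mono-≤ : ∀ a b c d .{{_ : ℕ.NonZero b}} .{{_ : ℕ.NonZero d}} →
              a ℕ.* d ℕ.≤ c ℕ.* b → a /ₙ b ≤ c /ₙ d
  /ₙ-mono-≤ a (suc b) c (suc d) le = ℚ.toℚᵘ-cancel-≤
    (ℚᵘ.≤-respʳ-≃ (ℚᵘ.≃-sym (toℚᵘ-/ₙ c d)) (ℚᵘ.≤-respˡ-≃ (ℚᵘ.≃-sym (toℚᵘ-/ₙ a b)) (mkℚᵘ-≤ a c b d le)))

  /ₙ-* : ∀ a b c d .{{_ : ℕ.NonZero b}} .{{_ : ℕ.NonZero d}} →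
         (a /ₙ b) * (c /ₙ d) ≡ ((a ℕ.* c) /ₙ (b ℕ.* d)) {{ℕ.m*n≢0 b d}}
  /ₙ-* a (suc b) c (suc d) = ℚ.toℚᵘ-injective (ℚᵘ.≃-trans (ℚ.toℚᵘ-homo-* (a /ₙ suc b) (c /ₙ suc d))
    (ℚᵘ.≃-trans (ℚᵘ.*-cong (toℚᵘ-/ₙ a b) (toℚᵘ-/ₙ c d))
    (ℚᵘ.≃-trans (ℚᵘ.≃-reflexive (cong (λ x → mkℚᵘ x _) (sym (ℤ.pos-* a c))))
      (ℚᵘ.≃-sym (toℚᵘ-/ₙ (a ℕ.* c) (d ℕ.+ b ℕ.* suc d))))))

  /ₙ-+ : ∀ a c d .{{_ : ℕ.NonZero d}} → (a /ₙ d) + (c /ₙ d) ≡ (a ℕ.+ c) /ₙ d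
  /ₙ-+ a c (suc d) = ℚ.toℚᵘ-injective (ℚᵘ.≃-trans (ℚ.toℚᵘ-homo-+ (a /ₙ suc d) (c /ₙ suc d))
    (ℚᵘ.≃-trans (ℚᵘ.+-cong (toℚᵘ-/ₙ a d) (toℚᵘ-/ₙ c d))
    (ℚᵘ.≃-trans sum≃ (ℚᵘ.≃-sym (toℚᵘ-/ₙ (a ℕ.+ c) d)))))
    where
    open ℕ-Solver
    sum≃ : mkℚᵘ (+ a) d ℚᵘ.+ mkℚᵘ (+ c) d ℚᵘ.≃ mkℚᵘ (+ (a ℕ.+ c)) d
    sum≃ = ℚᵘ.≃-trans
      (ℚᵘ.≃-reflexive (cong (λ x → mkℚᵘ x _) (trans (cong₂ ℤ._+_ (sym (ℤ.pos-* a (suc d))) (sym (ℤ.pos-* c (suc d))))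
                                                     (ℤ.pos-+ (a ℕ.* suc d) (c ℕ.* suc d)))))
      (mkℚᵘ-≃ _ _ _ _ (solve 3 (λ a c d → (a :* (con 1 :+ d) :+ c :* (con 1 :+ d)) :* (con 1 :+ d)
                                          := (a :+ c) :* ((con 1 :+ d) :* (con 1 :+ d))) refl a c d))

  archimedean : ∀ x → ∃ λ N → x ≤ N /ₙ 1
  archimedean (mkℚ (+ m) d _) = m , ℚ.toℚᵘ-cancel-≤
    (ℚᵘ.≤-respʳ-≃ (ℚᵘ.≃-sym (toℚᵘ-/ₙ m 0)) (mkℚᵘ-≤ m m d 0 (ℕ.*-monoʳ-≤ m (s≤s z≤n))))
  archimedean (mkℚ -[1+ m ] d _) = 0 , ℚ.toℚᵘ-cancel-≤ (*≤* ℤ.-≤+)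

fromℕ : ℕ → ℚ
fromℕ a = a /ₙ 1

0≤/ₙ : ∀ a d .{{_ : ℕ.NonZero d}} → 0ℚ ≤ a /ₙ d
0≤/ₙ a d = subst (_≤ a /ₙ d) 0/ₙ1≡0 (/ₙ-mono-≤ 0 1 a d z≤n)

fromℕ-+ : ∀ a b → fromℕ (a ℕ.+ b) ≡ fromℕ a + fromℕ b
fromℕ-+ a b = sym (/ₙ-+ a b 1)

fromℕ-* : ∀ a b → fromℕ (a ℕ.* b) ≡ fromℕ a * fromℕ b
fromℕ-* a b = sym (/ₙ-* a 1 b 1)

fromℕ-mono-≤ : ∀ {a b} → a ℕ.≤ b → fromℕ a ≤ fromℕ b
fromℕ-mono-≤ {a} {b} a≤b = /ₙ-mono-≤ a 1 b 1 (ℕ.*-monoˡ-≤ 1 a≤b)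

/ₙ-≡ : ∀ a b c d .{{_ : ℕ.NonZero b}} .{{_ : ℕ.NonZero d}} → a ℕ.* d ≡ c ℕ.* b → a /ₙ b ≡ c /ₙ d
/ₙ-≡ a b c d e = ℚ.≤-antisym (/ₙ-mono-≤ a b c d (ℕ.≤-reflexive e)) (/ₙ-mono-≤ c d a b (ℕ.≤-reflexive (sym e)))

fromℕ*1/ₙ≡1 : ∀ N .{{_ : ℕ.NonZero N}} → fromℕ N * (1 /ₙ N) ≡ 1ℚ
fromℕ*1/ₙ≡1 N = trans (/ₙ-* N 1 1 N) (trans (/ₙ-≡ (N ℕ.* 1) (1 ℕ.* N) 1 1 {{ℕ.m*n≢0 1 N}} cross) 1/ₙ1≡1)
  where
  cross : N ℕ.* 1 ℕ.* 1 ≡ 1 ℕ.* (1 ℕ.* N)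
  cross = trans (ℕ.*-identityʳ (N ℕ.* 1)) (trans (ℕ.*-identityʳ N) (sym (trans (ℕ.*-identityˡ _) (ℕ.*-identityˡ N))))

/ₙ2^≡½^ : ∀ c t → (c /ₙ 2 ℕ.^ t) {{ℕ.m^n≢0 2 t}} ≡ fromℕ c * ½ ^ t
/ₙ2^≡½^ c zero    = sym (ℚ.*-identityʳ (fromℕ c))
/ₙ2^≡½^ c (suc t) = begin
  (c /ₙ 2 ℕ.^ suc t) {{ℕ.m^n≢0 2 (suc t)}}         ≡⟨ cong (λ x → (x /ₙ 2 ℕ.^ suc t) {{ℕ.m^n≢0 2 (suc t)}}) (sym (ℕ.*-identityˡ c)) ⟩
  ((1 ℕ.* c) /ₙ 2 ℕ.^ suc t) {{ℕ.m^n≢0 2 (suc t)}} ≡⟨ sym (/ₙ-* 1 2 c (2 ℕ.^ t) {{_}} {{ℕ.m^n≢0 2 t}}) ⟩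
  (1 /ₙ 2) * (c /ₙ 2 ℕ.^ t) {{ℕ.m^n≢0 2 t}}        ≡⟨ cong (_* (c /ₙ 2 ℕ.^ t) {{ℕ.m^n≢0 2 t}}) (sym ½≡1/ₙ2) ⟩
  ½ * (c /ₙ 2 ℕ.^ t) {{ℕ.m^n≢0 2 t}}               ≡⟨ cong (½ *_) (/ₙ2^≡½^ c t) ⟩
  ½ * (fromℕ c * ½ ^ t)                            ≡⟨ ℚ.*-comm ½ (fromℕ c * ½ ^ t) ⟩
  (fromℕ c * ½ ^ t) * ½                            ≡⟨ ℚ.*-assoc (fromℕ c) (½ ^ t) ½ ⟩
  fromℕ c * (½ ^ t * ½)                            ≡⟨ cong (fromℕ c *_) (ℚ.*-comm (½ ^ t) ½) ⟩
  fromℕ c * ½ ^ suc t                              ∎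
  where open ≡-Reasoning

*-monoˡ-≤-0≤ : ∀ {r p q} → 0ℚ ≤ r → p ≤ q → r * p ≤ r * q
*-monoˡ-≤-0≤ {r} 0≤r = ℚ.*-monoˡ-≤-nonNeg r {{ℚ.nonNegative 0≤r}}

*-monoʳ-≤-0≤ : ∀ {r p q} → 0ℚ ≤ r → p ≤ q → p * r ≤ q * r
*-monoʳ-≤-0≤ {r} 0≤r = ℚ.*-monoʳ-≤-nonNeg r {{ℚ.nonNegative 0≤r}}

*-0≤ : ∀ {p q} → 0ℚ ≤ p → 0ℚ ≤ q → 0ℚ ≤ p * q
*-0≤ {p} 0≤p 0≤q = subst (_≤ p * _) (ℚ.*-zeroʳ p) (*-monoˡ-≤-0≤ 0≤p 0≤q)

≤-+-0≤ : ∀ p {q} → 0ℚ ≤ q → p ≤ p + q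
≤-+-0≤ p {q} 0≤q = subst (_≤ p + q) (ℚ.+-identityʳ p) (ℚ.+-monoʳ-≤ p 0≤q)

≤-0≤-+ : ∀ p {q} → 0ℚ ≤ q → p ≤ q + p
≤-0≤-+ p {q} 0≤q = subst (_≤ q + p) (ℚ.+-identityˡ p) (ℚ.+-monoˡ-≤ p 0≤q)

*-swapʳ : ∀ p q r → (p * q) * r ≡ (p * r) * q
*-swapʳ p q r = trans (ℚ.*-assoc p q r) (trans (cong (p *_) (ℚ.*-comm q r)) (sym (ℚ.*-assoc p r q)))

0≤fromℕ : ∀ a → 0ℚ ≤ fromℕ a
0≤fromℕ a = 0≤/ₙ a 1

^-0≤ : ∀ {r} → 0ℚ ≤ r → ∀ t → 0ℚ ≤ r ^ t
^-0≤ 0≤r zero    = subst (0ℚ ≤_) 1/ₙ1≡1 (0≤fromℕ 1)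
^-0≤ 0≤r (suc t) = *-0≤ 0≤r (^-0≤ 0≤r t)

0≤½ : 0ℚ ≤ ½
0≤½ = subst (0ℚ ≤_) (sym ½≡1/ₙ2) (0≤/ₙ 1 2)

-- Walk probabilities

walkProb : ℕ → ℕ → ℕ → ℚ
walkProb n i t = fromℕ (walks n i t) * ½ ^ t

P≡walkProb : ∀ n t → P n t ≡ walkProb n 1 t
P≡walkProb n t = begin
  P n t                                    ≡⟨ sym (/ₙ≡/ c (2 ℕ.^ t) {{ℕ.m^n≢0 2 t}}) ⟩
  (c /ₙ 2 ℕ.^ t) {{ℕ.m^n≢0 2 t}}           ≡⟨ cong (λ x → (x /ₙ 2 ℕ.^ t) {{ℕ.m^n≢0 2 t}}) (count≡countFrom n (allSteps t)) ⟩
  (walks n 1 t /ₙ 2 ℕ.^ t) {{ℕ.m^n≢0 2 t}} ≡⟨ /ₙ2^≡½^ (walks n 1 t) t ⟩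
  walkProb n 1 t                           ∎
  where
  open ≡-Reasoning
  c = count n (allSteps t)

module _ where
  open ℚ-Solver

  walkProb-suc-inBox : ∀ n i t → inBox n i →
    walkProb n i (suc t) ≡ ½ * walkProb n (suc i) t + ½ * walkProb n (i ∸ 1) t
  walkProb-suc-inBox n i t box = begin
    fromℕ (walks n i (suc t)) * ½ ^ suc t                 ≡⟨ cong (λ c → fromℕ c * ½ ^ suc t) (walks-suc-inBox n i t box) ⟩
    fromℕ (a ℕ.+ b) * (½ * ½ ^ t)                         ≡⟨ cong (_* (½ * ½ ^ t)) (fromℕ-+ a b) ⟩
    (fromℕ a + fromℕ b) * (½ * ½ ^ t)                     ≡⟨ solve 4 (λ a b h w → (a :+ b) :* (h :* w) := h :* (a :* w) :+ h :* (b :* w))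
                                                                  refl (fromℕ a) (fromℕ b) ½ (½ ^ t) ⟩
    ½ * walkProb n (suc i) t + ½ * walkProb n (i ∸ 1) t   ∎
    where
    open ≡-Reasoning
    a = walks n (suc i) t
    b = walks n (i ∸ 1) t

walkProb-outBox : ∀ n i t → 1 ℕ.≤ n → ¬ inBox n i → walkProb n i t ≡ 0ℚ
walkProb-outBox n i t 1≤n ¬box =
  trans (cong (λ c → fromℕ c * ½ ^ t) (walks-outBox n i t 1≤n ¬box))
        (trans (cong (_* ½ ^ t) 0/ₙ1≡0) (ℚ.*-zeroˡ (½ ^ t)))

walkProb-0≤ : ∀ n i t → 0ℚ ≤ walkProb n i t
walkProb-0≤ n i t = *-0≤ (0≤fromℕ (walks n i t)) (^-0≤ 0≤½ t)

walkProb-zero-target : ∀ n → 1 ℕ.≤ n → walkProb n n 0 ≡ 1ℚ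
walkProb-zero-target n 1≤n = trans (cong (λ c → fromℕ c * 1ℚ) (walks-zero-target n 1≤n))
                                   (cong (_* 1ℚ) 1/ₙ1≡1)

½^≤walkProb : ∀ k → ½ ^ k ≤ walkProb (suc k) 1 k
½^≤walkProb k = subst (_≤ walkProb (suc k) 1 k) (trans (cong (_* ½ ^ k) 1/ₙ1≡1) (ℚ.*-identityˡ (½ ^ k)))
  (*-monoʳ-≤-0≤ (^-0≤ 0≤½ k) (fromℕ-mono-≤ (walks-pos (suc k) 1 k ℕ.≤-refl refl)))

-- The discrete parabola and decay of the segment walk

parabola : ℕ → ℕ → ℕ
parabola n i = i ℕ.* (suc n ∸ i)

module _ where
  open ℕ-Solver

  parabola-concave : ∀ n i → inBox n i →
    parabola n (suc i) ℕ.+ parabola n (i ∸ 1) ℕ.+ 2 ≡ 2 ℕ.* parabola n i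
  parabola-concave n (suc a) (_ , a<n) with b , refl ← ℕ.m≤n⇒∃[o]m+o≡n a<n = begin
    parabola n (suc (suc a)) ℕ.+ parabola n a ℕ.+ 2 ≡⟨ cong₂ (λ x y → suc (suc a) ℕ.* x ℕ.+ a ℕ.* y ℕ.+ 2) (ℕ.m+n∸m≡n a b) gap₀ ⟩
    suc (suc a) ℕ.* b ℕ.+ a ℕ.* suc (suc b) ℕ.+ 2     ≡⟨ solve 2 (λ a b → (con 2 :+ a) :* b :+ a :* (con 2 :+ b) :+ con 2
                                                                    := con 2 :* ((con 1 :+ a) :* (con 1 :+ b))) refl a b ⟩
    2 ℕ.* (suc a ℕ.* suc b)                           ≡⟨ cong (λ x → 2 ℕ.* (suc a ℕ.* x)) (sym gap₁) ⟩
    2 ℕ.* parabola n (suc a)                          ∎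
    where
    open ≡-Reasoning
    gap₁ : suc (a ℕ.+ b) ∸ a ≡ suc b
    gap₁ = trans (cong (_∸ a) (sym (ℕ.+-suc a b))) (ℕ.m+n∸m≡n a (suc b))
    gap₀ : suc (suc (a ℕ.+ b)) ∸ a ≡ suc (suc b)
    gap₀ = trans (cong (λ x → suc x ∸ a) (sym (ℕ.+-suc a b)))
                 (trans (cong (_∸ a) (sym (ℕ.+-suc a (suc b)))) (ℕ.m+n∸m≡n a (suc (suc b))))

  parabola-≤ : ∀ n i → inBox n i → parabola n i ℕ.≤ n ℕ.* n
  parabola-≤ n (suc a) (_ , i≤n) = ℕ.*-mono-≤ i≤n (ℕ.m∸n≤m n a)

  parabola-pos : ∀ n i → inBox n i → 1 ℕ.≤ parabola n i
  parabola-pos n i (1≤i , i≤n) = ℕ.*-mono-≤ 1≤i (ℕ.m<n⇒0<n∸m (s≤s i≤n))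

  parabola-outBox : ∀ n i → ¬ inBox n i → parabola n i ≡ 0
  parabola-outBox n zero    ¬box = refl
  parabola-outBox n (suc a) ¬box with suc a ℕ.≤? n
  ... | yes i≤n = ⊥-elim (¬box (s≤s z≤n , i≤n))
  ... | no  i≰n = trans (cong (suc a ℕ.*_) (ℕ.m≤n⇒m∸n≡0 (ℕ.≰⇒> i≰n))) (ℕ.*-zeroʳ (suc a))

  parabola-first : ∀ n → parabola n 1 ≡ n
  parabola-first n = ℕ.+-identityʳ n

  parabola-last : ∀ n → parabola n n ≡ n
  parabola-last n = trans (cong (n ℕ.*_) (trans (ℕ.+-∸-assoc 1 (ℕ.≤-refl {n})) (cong suc (ℕ.n∸n≡0 n))))
                          (ℕ.*-identityʳ n)

  superharmonic-margin : ∀ S a g d F L → S ℕ.+ a ℕ.* g ≡ d ℕ.* F → d ℕ.* F ℕ.≤ a ℕ.* g ℕ.* suc L →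
                         S ℕ.* suc L ℕ.≤ d ℕ.* L ℕ.* F
  superharmonic-margin S a g d F L identity bound = ℕ.+-cancelʳ-≤ (a ℕ.* g ℕ.* suc L) _ _ (begin
    S ℕ.* suc L ℕ.+ a ℕ.* g ℕ.* suc L ≡⟨ sym (ℕ.*-distribʳ-+ (suc L) S (a ℕ.* g)) ⟩
    (S ℕ.+ a ℕ.* g) ℕ.* suc L         ≡⟨ cong (ℕ._* suc L) identity ⟩
    d ℕ.* F ℕ.* suc L                 ≡⟨ solve 3 (λ d F L → d :* F :* (con 1 :+ L) := d :* L :* F :+ d :* F) refl d F L ⟩
    d ℕ.* L ℕ.* F ℕ.+ d ℕ.* F         ≤⟨ ℕ.+-monoʳ-≤ (d ℕ.* L ℕ.* F) bound ⟩
    d ℕ.* L ℕ.* F ℕ.+ a ℕ.* g ℕ.* suc L ∎)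
    where open ℕ.≤-Reasoning

ratio : ℕ → ℚ
ratio L = L /ₙ suc L

0≤ratio : ∀ L → 0ℚ ≤ ratio L
0≤ratio L = 0≤/ₙ L (suc L)

margin⇒ratio : ∀ S d F L .{{_ : ℕ.NonZero d}} → S ℕ.* suc L ℕ.≤ d ℕ.* L ℕ.* F →
               (1 /ₙ d) * fromℕ S ≤ ratio L * fromℕ F
margin⇒ratio S d F L margin = begin
  (1 /ₙ d) * fromℕ S                       ≡⟨ /ₙ-* 1 d S 1 ⟩
  ((1 ℕ.* S) /ₙ (d ℕ.* 1)) {{ℕ.m*n≢0 d 1}} ≤⟨ /ₙ-mono-≤ _ _ _ _ {{ℕ.m*n≢0 d 1}} cross ⟩
  (L ℕ.* F) /ₙ (suc L ℕ.* 1)               ≡⟨ sym (/ₙ-* L (suc L) F 1) ⟩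
  ratio L * fromℕ F                        ∎
  where
  open ℚ.≤-Reasoning
  open ℕ-Solver
  cross : 1 ℕ.* S ℕ.* (suc L ℕ.* 1) ℕ.≤ L ℕ.* F ℕ.* (d ℕ.* 1)
  cross = subst₂ ℕ._≤_
    (solve 2 (λ S L → S :* (con 1 :+ L) := con 1 :* S :* ((con 1 :+ L) :* con 1)) refl S L)
    (solve 3 (λ d L F → d :* L :* F := L :* F :* (d :* con 1)) refl d L F) margin

parabola-superharmonic : ∀ n L → suc L ≡ n ℕ.* n → ∀ i → inBox n i →
  ½ * fromℕ (parabola n (suc i)) + ½ * fromℕ (parabola n (i ∸ 1)) ≤ ratio L * fromℕ (parabola n i)
parabola-superharmonic n L sucL≡n² i box = begin
  ½ * fromℕ a + ½ * fromℕ b  ≡⟨ sym (ℚ.*-distribˡ-+ ½ (fromℕ a) (fromℕ b)) ⟩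
  ½ * (fromℕ a + fromℕ b)    ≡⟨ cong (½ *_) (sym (fromℕ-+ a b)) ⟩
  ½ * fromℕ (a ℕ.+ b)        ≡⟨ cong (_* fromℕ (a ℕ.+ b)) ½≡1/ₙ2 ⟩
  (1 /ₙ 2) * fromℕ (a ℕ.+ b) ≤⟨ margin⇒ratio (a ℕ.+ b) 2 F L (superharmonic-margin (a ℕ.+ b) 2 1 2 F L
                                  (parabola-concave n i box)
                                  (ℕ.*-monoʳ-≤ 2 (subst (F ℕ.≤_) (sym sucL≡n²) (parabola-≤ n i box)))) ⟩
  ratio L * fromℕ F          ∎
  where
  open ℚ.≤-Reasoning
  a = parabola n (suc i)
  b = parabola n (i ∸ 1)
  F = parabola n i

module _ where
  open ℚ-Solver

  walkProb-decay : ∀ n L → 1 ℕ.≤ n → suc L ≡ n ℕ.* n → ∀ t i →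
    fromℕ n * walkProb n i t ≤ ratio L ^ t * fromℕ (parabola n i)
  walkProb-decay n L 1≤n sucL≡n² zero i = begin
    fromℕ n * (fromℕ (walks n i 0) * 1ℚ) ≡⟨ cong (fromℕ n *_) (ℚ.*-identityʳ _) ⟩
    fromℕ n * fromℕ (walks n i 0)        ≡⟨ sym (fromℕ-* n (walks n i 0)) ⟩
    fromℕ (n ℕ.* walks n i 0)            ≤⟨ fromℕ-mono-≤ (initial (i ℕ.≟ n)) ⟩
    fromℕ (parabola n i)                 ≡⟨ sym (ℚ.*-identityˡ _) ⟩
    1ℚ * fromℕ (parabola n i)            ∎
    where
    open ℚ.≤-Reasoning
    initial : Dec (i ≡ n) → n ℕ.* walks n i 0 ℕ.≤ parabola n i
    initial (yes refl) = ℕ.≤-reflexive (trans (cong (n ℕ.*_) (walks-zero-target n 1≤n))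
                                            (trans (ℕ.*-identityʳ n) (sym (parabola-last n))))
    initial (no i≢n)   = subst (ℕ._≤ parabola n i) (sym (trans (cong (n ℕ.*_) (walks-zero-≢ n i i≢n)) (ℕ.*-zeroʳ n))) z≤n
  walkProb-decay n L 1≤n sucL≡n² (suc t) i with inBox? n i
  ... | no ¬box = begin
    fromℕ n * walkProb n i (suc t)    ≡⟨ cong (fromℕ n *_) (walkProb-outBox n i (suc t) 1≤n ¬box) ⟩
    fromℕ n * 0ℚ                      ≡⟨ ℚ.*-zeroʳ (fromℕ n) ⟩
    0ℚ                                ≤⟨ *-0≤ (^-0≤ (0≤ratio L) (suc t)) (0≤fromℕ _) ⟩
    ratio L ^ suc t * fromℕ (parabola n i) ∎
    where open ℚ.≤-Reasoning
  ... | yes box = begin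
    fromℕ n * walkProb n i (suc t)
      ≡⟨ cong (fromℕ n *_) (walkProb-suc-inBox n i t box) ⟩
    fromℕ n * (½ * walkProb n (suc i) t + ½ * walkProb n (i ∸ 1) t)
      ≡⟨ solve 4 (λ n h a b → n :* (h :* a :+ h :* b) := h :* (n :* a) :+ h :* (n :* b))
           refl (fromℕ n) ½ (walkProb n (suc i) t) (walkProb n (i ∸ 1) t) ⟩
    ½ * (fromℕ n * walkProb n (suc i) t) + ½ * (fromℕ n * walkProb n (i ∸ 1) t)
      ≤⟨ ℚ.+-mono-≤ (*-monoˡ-≤-0≤ 0≤½ (walkProb-decay n L 1≤n sucL≡n² t (suc i)))
                    (*-monoˡ-≤-0≤ 0≤½ (walkProb-decay n L 1≤n sucL≡n² t (i ∸ 1))) ⟩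
    ½ * (ρᵗ * fromℕ (parabola n (suc i))) + ½ * (ρᵗ * fromℕ (parabola n (i ∸ 1)))
      ≡⟨ solve 4 (λ h r a b → h :* (r :* a) :+ h :* (r :* b) := r :* (h :* a :+ h :* b))
           refl ½ ρᵗ (fromℕ (parabola n (suc i))) (fromℕ (parabola n (i ∸ 1))) ⟩
    ρᵗ * (½ * fromℕ (parabola n (suc i)) + ½ * fromℕ (parabola n (i ∸ 1)))
      ≤⟨ *-monoˡ-≤-0≤ (^-0≤ (0≤ratio L) t) (parabola-superharmonic n L sucL≡n² i box) ⟩
    ρᵗ * (ratio L * fromℕ (parabola n i))
      ≡⟨ solve 3 (λ r ρ p → r :* (ρ :* p) := ρ :* r :* p) refl ρᵗ (ratio L) (fromℕ (parabola n i)) ⟩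
    ratio L ^ suc t * fromℕ (parabola n i) ∎
    where
    open ℚ.≤-Reasoning
    ρᵗ = ratio L ^ t

walkProb-first-≤ : ∀ n L → 1 ℕ.≤ n → suc L ≡ n ℕ.* n → ∀ t → walkProb n 1 t ≤ ratio L ^ t
walkProb-first-≤ (suc k) L 1≤n sucL≡n² t = ℚ.*-cancelˡ-≤-pos (fromℕ (suc k)) {{suc/ₙ1-pos k}}
  (subst (fromℕ (suc k) * walkProb (suc k) 1 t ≤_)
         (trans (cong (ratio L ^ t *_) (cong fromℕ (parabola-first (suc k)))) (ℚ.*-comm (ratio L ^ t) _))
         (walkProb-decay (suc k) L 1≤n sucL≡n² t 1))

-- Powers of L / (L + 1) and the maximum of P

ratio-^ : ∀ L T → ratio L ^ T ≡ (L ℕ.^ T /ₙ suc L ℕ.^ T) {{ℕ.m^n≢0 (suc L) T}}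
ratio-^ L zero    = sym 1/ₙ1≡1
ratio-^ L (suc T) = trans (cong (ratio L *_) (ratio-^ L T))
                          (/ₙ-* L (suc L) (L ℕ.^ T) (suc L ℕ.^ T) {{_}} {{ℕ.m^n≢0 (suc L) T}})

module _ where
  open ℕ-Solver

  bernoulli : ∀ L T → L ℕ.^ T ℕ.* (L ℕ.+ T) ℕ.≤ suc L ℕ.^ T ℕ.* L
  bernoulli L zero    = ℕ.≤-reflexive (cong (ℕ._+ 0) (ℕ.+-identityʳ L))
  bernoulli L (suc T) = begin
    L ℕ.^ suc T ℕ.* (L ℕ.+ suc T)
      ≡⟨ solve 3 (λ L Lᵀ T → L :* Lᵀ :* (L :+ (con 1 :+ T)) := L :* (Lᵀ :* (L :+ T)) :+ L :* Lᵀ) refl L (L ℕ.^ T) T ⟩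
    L ℕ.* (L ℕ.^ T ℕ.* (L ℕ.+ T)) ℕ.+ L ℕ.* L ℕ.^ T
      ≤⟨ ℕ.+-mono-≤ (ℕ.*-monoʳ-≤ L (bernoulli L T)) (ℕ.*-monoʳ-≤ L (ℕ.^-monoˡ-≤ T (ℕ.n≤1+n L))) ⟩
    L ℕ.* (suc L ℕ.^ T ℕ.* L) ℕ.+ L ℕ.* suc L ℕ.^ T
      ≡⟨ solve 2 (λ L x → L :* (x :* L) :+ L :* x := (con 1 :+ L) :* x :* L) refl L (suc L ℕ.^ T) ⟩
    suc L ℕ.^ suc T ℕ.* L ∎
    where open ℕ.≤-Reasoning

  ratio^≤ : ∀ L N T .{{_ : ℕ.NonZero N}} → 1 ℕ.≤ L → L ℕ.* N ℕ.≤ T → ratio L ^ T ≤ 1 /ₙ N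
  ratio^≤ L N T 1≤L LN≤T = subst (_≤ 1 /ₙ N) (sym (ratio-^ L T))
    (/ₙ-mono-≤ (L ℕ.^ T) (suc L ℕ.^ T) 1 N {{ℕ.m^n≢0 (suc L) T}}
      (subst (L ℕ.^ T ℕ.* N ℕ.≤_) (sym (ℕ.*-identityˡ _))
        (ℕ.*-cancelʳ-≤ _ _ L {{ℕ.>-nonZero 1≤L}} (begin
          L ℕ.^ T ℕ.* N ℕ.* L   ≡⟨ solve 3 (λ a N L → a :* N :* L := a :* (L :* N)) refl (L ℕ.^ T) N L ⟩
          L ℕ.^ T ℕ.* (L ℕ.* N) ≤⟨ ℕ.*-monoʳ-≤ (L ℕ.^ T) (ℕ.≤-trans LN≤T (ℕ.m≤n+m T L)) ⟩
          L ℕ.^ T ℕ.* (L ℕ.+ T) ≤⟨ bernoulli L T ⟩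
          suc L ℕ.^ T ℕ.* L     ∎))))
    where open ℕ.≤-Reasoning

ratio^-eventually-≤ : ∀ L C ε → 1 ℕ.≤ L → 0ℚ < ε → ∃ λ T → C * ratio L ^ T ≤ ε
ratio^-eventually-≤ L C ε 1≤L 0<ε = L ℕ.* N , (begin
  C * ratio L ^ (L ℕ.* N)             ≤⟨ *-monoʳ-≤-0≤ (^-0≤ (0≤ratio L) (L ℕ.* N)) C≤Nε ⟩
  (fromℕ N * ε) * ratio L ^ (L ℕ.* N) ≤⟨ *-monoˡ-≤-0≤ 0≤Nε (ratio^≤ L N (L ℕ.* N) 1≤L ℕ.≤-refl) ⟩
  (fromℕ N * ε) * (1 /ₙ N)            ≡⟨ *-swapʳ (fromℕ N) ε (1 /ₙ N) ⟩
  (fromℕ N * (1 /ₙ N)) * ε            ≡⟨ trans (cong (_* ε) (fromℕ*1/ₙ≡1 N)) (ℚ.*-identityˡ ε) ⟩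
  ε                                   ∎)
  where
  open ℚ.≤-Reasoning
  instance
    ε≢0 : ℚ.NonZero ε
    ε≢0 = ℚ.pos⇒nonZero ε {{ℚ.positive 0<ε}}
  archimedean-C/ε = archimedean (C * ℚ.1/ ε)
  N₀ = proj₁ archimedean-C/ε
  N = suc N₀
  0≤ε = ℚ.<⇒≤ 0<ε
  0≤Nε = *-0≤ (0≤fromℕ N) 0≤ε
  C≤Nε : C ≤ fromℕ N * ε
  C≤Nε = begin
    C                        ≡⟨ sym (trans (ℚ.*-assoc C (ℚ.1/ ε) ε) (trans (cong (C *_) (ℚ.*-inverseˡ ε)) (ℚ.*-identityʳ C))) ⟩
    (C * ℚ.1/ ε) * ε         ≤⟨ *-monoʳ-≤-0≤ 0≤ε (ℚ.≤-trans (proj₂ archimedean-C/ε) (fromℕ-mono-≤ (ℕ.n≤1+n N₀))) ⟩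
    fromℕ N * ε              ∎

module _ where
  open Data.List.Extrema (DecTotalOrder.totalOrder ℚ.≤-decTotalOrder) using (argmax; f[xs]≤f[argmax])

  attainsMax : ∀ (g : ℕ → ℚ) k N → k ℕ.< N → (∀ t → N ℕ.≤ t → g t ≤ g k) →
               Σ ℕ λ t₀ → ∀ t → g t ≤ g t₀
  attainsMax g k N k<N tail = t₀ , bound
    where
    t₀ = argmax g 0 (upTo N)
    below : ∀ {t} → t ℕ.< N → g t ≤ g t₀
    below t<N = All.lookup (f[xs]≤f[argmax] 0 (upTo N)) (∈-upTo⁺ t<N)
    bound : ∀ t → g t ≤ g t₀
    bound t with t ℕ.<? N
    ... | yes t<N = below t<N
    ... | no  t≮N = ℚ.≤-trans (tail t (ℕ.≮⇒≥ t≮N)) (below k<N)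

P-attainsMax : ∀ n → 2 ℕ.≤ n → Σ ℕ λ t₀ → ∀ t → P n t ≤ P n t₀
P-attainsMax n@(suc k) (s≤s 1≤k) = attainsMax (P n) k N (ℕ.m≤n+m n (L ℕ.* 2 ℕ.^ k)) tail
  where
  L = k ℕ.+ k ℕ.* n
  N = L ℕ.* 2 ℕ.^ k ℕ.+ n
  tail : ∀ t → N ℕ.≤ t → P n t ≤ P n k
  tail t N≤t = begin
    P n t                                 ≡⟨ P≡walkProb n t ⟩
    walkProb n 1 t                        ≤⟨ walkProb-first-≤ n L (s≤s z≤n) refl t ⟩
    ratio L ^ t                           ≤⟨ ratio^≤ L (2 ℕ.^ k) t {{ℕ.m^n≢0 2 k}} (ℕ.≤-trans 1≤k (ℕ.m≤m+n k _))
                                               (ℕ.≤-trans (ℕ.m≤m+n _ n) N≤t) ⟩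
    (1 /ₙ 2 ℕ.^ k) {{ℕ.m^n≢0 2 k}}        ≡⟨ /ₙ2^≡½^ 1 k ⟩
    fromℕ 1 * ½ ^ k                       ≡⟨ trans (cong (_* ½ ^ k) 1/ₙ1≡1) (ℚ.*-identityˡ (½ ^ k)) ⟩
    ½ ^ k                                 ≤⟨ ½^≤walkProb k ⟩
    walkProb n 1 k                        ≡⟨ sym (P≡walkProb n k) ⟩
    P n k                                 ∎
    where open ℚ.≤-Reasoning

-- Interleaving two walks

sumUpTo : ℕ → (ℕ → ℚ) → ℚ
sumUpTo zero    g = 0ℚ
sumUpTo (suc T) g = g 0 + sumUpTo T (λ t → g (suc t))

module _ where
  open ℚ-Solver

  sumUpTo-cong : ∀ T {g h} → (∀ t → g t ≡ h t) → sumUpTo T g ≡ sumUpTo T h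
  sumUpTo-cong zero    g≗h = refl
  sumUpTo-cong (suc T) g≗h = cong₂ _+_ (g≗h 0) (sumUpTo-cong T (λ t → g≗h (suc t)))

  sumUpTo-linear : ∀ T c d g h → sumUpTo T (λ t → c * g t + d * h t) ≡ c * sumUpTo T g + d * sumUpTo T h
  sumUpTo-linear zero    c d g h = solve 2 (λ c d → con 0ℚ := c :* con 0ℚ :+ d :* con 0ℚ) refl c d
  sumUpTo-linear (suc T) c d g h rewrite sumUpTo-linear T c d (λ t → g (suc t)) (λ t → h (suc t)) =
    solve 6 (λ c d g₀ h₀ G H → (c :* g₀ :+ d :* h₀) :+ (c :* G :+ d :* H) := c :* (g₀ :+ G) :+ d :* (h₀ :+ H))
      refl c d (g 0) (h 0) (sumUpTo T (λ t → g (suc t))) (sumUpTo T (λ t → h (suc t)))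

  sumUpTo-suc : ∀ T g → sumUpTo (suc T) g ≡ sumUpTo T g + g T
  sumUpTo-suc zero    g = ℚ.+-comm (g 0) 0ℚ
  sumUpTo-suc (suc T) g rewrite sumUpTo-suc T (λ t → g (suc t)) = sym (ℚ.+-assoc (g 0) _ _)

sumUpTo-0≤ : ∀ T {g} → (∀ t → 0ℚ ≤ g t) → 0ℚ ≤ sumUpTo T g
sumUpTo-0≤ zero    0≤g = ℚ.≤-refl
sumUpTo-0≤ (suc T) 0≤g = ℚ.+-mono-≤ (0≤g 0) (sumUpTo-0≤ T (λ t → 0≤g (suc t)))

sumUpTo-≤-suc : ∀ T {g} → (∀ t → 0ℚ ≤ g t) → sumUpTo T g ≤ sumUpTo (suc T) g
sumUpTo-≤-suc T {g} 0≤g = subst₂ _≤_ (ℚ.+-identityʳ (sumUpTo T g)) (sym (sumUpTo-suc T g))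
  (ℚ.+-monoʳ-≤ (sumUpTo T g) (0≤g T))

sumUpTo-zero : ∀ T {g} → (∀ t → g t ≡ 0ℚ) → sumUpTo T g ≡ 0ℚ
sumUpTo-zero T {g} g≗0 = trans (sumUpTo-cong T g≗0) (const-zero T)
  where
  const-zero : ∀ T → sumUpTo T (λ _ → 0ℚ) ≡ 0ℚ
  const-zero zero    = refl
  const-zero (suc T) = trans (ℚ.+-identityˡ _) (const-zero T)

Psum≡sumUpTo : ∀ n T → Psum n T ≡ sumUpTo T (P n)
Psum≡sumUpTo n zero    = refl
Psum≡sumUpTo n (suc T) = trans (cong (_+ P n T) (Psum≡sumUpTo n T)) (sym (sumUpTo-suc T (P n)))

-- interleave t a b = Σ_k C(t, k) 2^−t · a k · b (t − k), as the grid walk moves a uniformly chosen coordinate.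
interleave : ℕ → (ℕ → ℚ) → (ℕ → ℚ) → ℚ
interleave zero    a b = a 0 * b 0
interleave (suc t) a b = ½ * interleave t (λ k → a (suc k)) b + ½ * interleave t a (λ k → b (suc k))

interleave-cong : ∀ t {a a′ b b′} → (∀ k → a k ≡ a′ k) → (∀ k → b k ≡ b′ k) →
                  interleave t a b ≡ interleave t a′ b′
interleave-cong zero    a≗ b≗ = cong₂ _*_ (a≗ 0) (b≗ 0)
interleave-cong (suc t) a≗ b≗ = cong₂ (λ x y → ½ * x + ½ * y)
  (interleave-cong t (λ k → a≗ (suc k)) b≗) (interleave-cong t a≗ (λ k → b≗ (suc k)))

module _ where
  open ℚ-Solver

  interleave-linearˡ : ∀ t c d a a′ b →
    interleave t (λ k → c * a k + d * a′ k) b ≡ c * interleave t a b + d * interleave t a′ b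
  interleave-linearˡ zero c d a a′ b =
    solve 5 (λ c d x y z → (c :* x :+ d :* y) :* z := c :* (x :* z) :+ d :* (y :* z)) refl c d (a 0) (a′ 0) (b 0)
  interleave-linearˡ (suc t) c d a a′ b
    rewrite interleave-linearˡ t c d (λ k → a (suc k)) (λ k → a′ (suc k)) b
          | interleave-linearˡ t c d a a′ (λ k → b (suc k)) =
    solve 6 (λ c d x y z w → con ½ :* (c :* x :+ d :* y) :+ con ½ :* (c :* z :+ d :* w)
                           := c :* (con ½ :* x :+ con ½ :* z) :+ d :* (con ½ :* y :+ con ½ :* w))
      refl c d _ _ _ _

  interleave-linearʳ : ∀ t c d a b b′ →
    interleave t a (λ k → c * b k + d * b′ k) ≡ c * interleave t a b + d * interleave t a b′
  interleave-linearʳ zero c d a b b′ =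
    solve 5 (λ c d x y z → z :* (c :* x :+ d :* y) := c :* (z :* x) :+ d :* (z :* y)) refl c d (b 0) (b′ 0) (a 0)
  interleave-linearʳ (suc t) c d a b b′
    rewrite interleave-linearʳ t c d (λ k → a (suc k)) b b′
          | interleave-linearʳ t c d a (λ k → b (suc k)) (λ k → b′ (suc k)) =
    solve 6 (λ c d x y z w → con ½ :* (c :* x :+ d :* y) :+ con ½ :* (c :* z :+ d :* w)
                           := c :* (con ½ :* x :+ con ½ :* z) :+ d :* (con ½ :* y :+ con ½ :* w))
      refl c d _ _ _ _

interleave-0≤ : ∀ t {a b} → (∀ k → 0ℚ ≤ a k) → (∀ k → 0ℚ ≤ b k) → 0ℚ ≤ interleave t a b
interleave-0≤ zero    0≤a 0≤b = *-0≤ (0≤a 0) (0≤b 0)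
interleave-0≤ (suc t) 0≤a 0≤b = ℚ.+-mono-≤
  (*-0≤ 0≤½ (interleave-0≤ t (λ k → 0≤a (suc k)) 0≤b)) (*-0≤ 0≤½ (interleave-0≤ t 0≤a (λ k → 0≤b (suc k))))

interleave-zeroˡ : ∀ t {a} b → (∀ k → a k ≡ 0ℚ) → interleave t a b ≡ 0ℚ
interleave-zeroˡ zero    b a≗0 = trans (cong (_* b 0) (a≗0 0)) (ℚ.*-zeroˡ (b 0))
interleave-zeroˡ (suc t) b a≗0
  rewrite interleave-zeroˡ t b (λ k → a≗0 (suc k)) | interleave-zeroˡ t (λ k → b (suc k)) a≗0 = refl

interleave-zeroʳ : ∀ t a {b} → (∀ k → b k ≡ 0ℚ) → interleave t a b ≡ 0ℚ
interleave-zeroʳ zero    a b≗0 = trans (cong (a 0 *_) (b≗0 0)) (ℚ.*-zeroʳ (a 0))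
interleave-zeroʳ (suc t) a b≗0
  rewrite interleave-zeroʳ t (λ k → a (suc k)) b≗0 | interleave-zeroʳ t a (λ k → b≗0 (suc k)) = refl

module _ where
  open ℚ-Solver

  sumUpTo-interleave-≤ : ∀ T {a b} M → 0ℚ ≤ M → (∀ k → 0ℚ ≤ a k) → (∀ k → b k ≤ M) →
    sumUpTo T (λ t → interleave t a b) ≤ ((+ 2 / 1) * M) * sumUpTo T a
  sumUpTo-interleave-≤ zero M 0≤M 0≤a b≤M = ℚ.≤-reflexive (sym (ℚ.*-zeroʳ ((+ 2 / 1) * M)))
  sumUpTo-interleave-≤ (suc T) {a} {b} M 0≤M 0≤a b≤M = begin
    a 0 * b 0 + sumUpTo T (λ t → ½ * interleave t a⁺ b + ½ * interleave t a b⁺)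
      ≡⟨ cong (λ x → a 0 * b 0 + x) (sumUpTo-linear T ½ ½ _ _) ⟩
    a 0 * b 0 + (½ * sumUpTo T (λ t → interleave t a⁺ b) + ½ * sumUpTo T (λ t → interleave t a b⁺))
      ≤⟨ ℚ.+-mono-≤ (*-monoˡ-≤-0≤ (0≤a 0) (b≤M 0))
           (ℚ.+-mono-≤ (*-monoˡ-≤-0≤ 0≤½ (sumUpTo-interleave-≤ T M 0≤M (λ k → 0≤a (suc k)) b≤M))
                       (*-monoˡ-≤-0≤ 0≤½ (sumUpTo-interleave-≤ T M 0≤M 0≤a (λ k → b≤M (suc k))))) ⟩
    a 0 * M + (½ * ((+ 2 / 1) * M * A⁺) + ½ * ((+ 2 / 1) * M * A))
      ≡⟨ solve 4 (λ a₀ M A⁺ A → a₀ :* M :+ (con ½ :* (con (+ 2 / 1) :* M :* A⁺) :+ con ½ :* (con (+ 2 / 1) :* M :* A))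
                                := M :* (a₀ :+ A⁺) :+ M :* A) refl (a 0) M A⁺ A ⟩
    M * (a 0 + A⁺) + M * A
      ≤⟨ ℚ.+-monoʳ-≤ (M * (a 0 + A⁺)) (*-monoˡ-≤-0≤ 0≤M (sumUpTo-≤-suc T 0≤a)) ⟩
    M * (a 0 + A⁺) + M * (a 0 + A⁺)
      ≡⟨ solve 2 (λ M S → M :* S :+ M :* S := con (+ 2 / 1) :* M :* S) refl M (a 0 + A⁺) ⟩
    (+ 2 / 1) * M * sumUpTo (suc T) a ∎
    where
    open ℚ.≤-Reasoning
    a⁺ = λ k → a (suc k)
    b⁺ = λ k → b (suc k)
    A⁺ = sumUpTo T a⁺
    A  = sumUpTo T a

-- Functions on the grid

boundedUpTo : ∀ (g : ℕ → ℚ) n → ∃ λ B → 0ℚ ≤ B × (∀ i → i ℕ.≤ n → g i ≤ B)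
boundedUpTo g zero = g 0 ⊔ 0ℚ , ℚ.p≤q⊔p (g 0) 0ℚ , λ { i z≤n → ℚ.p≤p⊔q (g 0) 0ℚ }
boundedUpTo g (suc n) with B , 0≤B , g≤B ← boundedUpTo g n =
  B ⊔ g (suc n) , ℚ.≤-trans 0≤B (ℚ.p≤p⊔q B _) , bound
  where
  bound : ∀ i → i ℕ.≤ suc n → g i ≤ B ⊔ g (suc n)
  bound i i≤1+n with ℕ.m≤n⇒m<n∨m≡n i≤1+n
  ... | inj₁ i<1+n = ℚ.≤-trans (g≤B i (ℕ.m<1+n⇒m≤n i<1+n)) (ℚ.p≤p⊔q B _)
  ... | inj₂ refl  = ℚ.p≤q⊔p B (g (suc n))

boundedOnSquare : ∀ (h : ℕ → ℕ → ℚ) n →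
  ∃ λ B → 0ℚ ≤ B × (∀ i j → i ℕ.≤ n → j ℕ.≤ n → h i j ≤ B)
boundedOnSquare h n = B , 0≤B , λ i j i≤n j≤n → ℚ.≤-trans (proj₂ (proj₂ (row i)) j j≤n) (R≤B i i≤n)
  where
  row : ∀ i → ∃ λ B → 0ℚ ≤ B × (∀ j → j ℕ.≤ n → h i j ≤ B)
  row i = boundedUpTo (h i) n
  column = boundedUpTo (λ i → proj₁ (row i)) n
  B = proj₁ column
  0≤B = proj₁ (proj₂ column)
  R≤B = proj₂ (proj₂ column)

InSquare : ℕ → ℕ → ℕ → Set
InSquare n i j = inBox n i × inBox n j

T-inSquare : ∀ {n i j} → T ((1 ℕ.≤ᵇ i) ∧ (i ℕ.≤ᵇ n) ∧ (1 ℕ.≤ᵇ j) ∧ (j ℕ.≤ᵇ n)) ⇔ InSquare n i j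
T-inSquare {n} {i} {j} = ⇔.trans T-∧ (⇔.trans (≤ᵇ⇔ ×-⇔ ⇔.trans T-∧ (≤ᵇ⇔ ×-⇔ ⇔.trans T-∧ (≤ᵇ⇔ ×-⇔ ≤ᵇ⇔))) regroup)
  where
  ≤ᵇ⇔ : ∀ {a b} → T (a ℕ.≤ᵇ b) ⇔ a ℕ.≤ b
  ≤ᵇ⇔ {a} {b} = mk⇔ (ℕ.≤ᵇ⇒≤ a b) ℕ.≤⇒≤ᵇ
  regroup : ∀ {A B C D : Set} → (A × B × C × D) ⇔ ((A × B) × (C × D))
  regroup = mk⇔ (λ (a , b , c , d) → (a , b) , (c , d)) (λ ((a , b) , (c , d)) → a , b , c , d)

val-inSquare : ∀ n g i j → InSquare n i j → val n g i j ≡ g i j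
val-inSquare n g i j sq = if-T (g i j) 0ℚ (Equivalence.from T-inSquare sq)

val-outSquare : ∀ n g i j → ¬ InSquare n i j → val n g i j ≡ 0ℚ
val-outSquare n g i j ¬sq = if-¬T (g i j) 0ℚ (λ t → ¬sq (Equivalence.to T-inSquare t))

val-vanishing : ∀ n g → (∀ i j → ¬ InSquare n i j → g i j ≡ 0ℚ) → ∀ i j → val n g i j ≡ g i j
val-vanishing n g g≡0 i j with inBox? n i ×-dec inBox? n j
... | yes sq  = val-inSquare n g i j sq
... | no  ¬sq = trans (val-outSquare n g i j ¬sq) (sym (g≡0 i j ¬sq))

module _ where
  open ℚ-Solver

  val-affine-≤ : ∀ n g₁ g₂ g₃ c → (∀ i j → InSquare n i j → g₁ i j ≤ g₂ i j + c * g₃ i j) →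
                 ∀ i j → val n g₁ i j ≤ val n g₂ i j + c * val n g₃ i j
  val-affine-≤ n g₁ g₂ g₃ c g₁≤ i j with inBox? n i ×-dec inBox? n j
  ... | yes sq rewrite val-inSquare n g₁ i j sq | val-inSquare n g₂ i j sq | val-inSquare n g₃ i j sq = g₁≤ i j sq
  ... | no ¬sq rewrite val-outSquare n g₁ i j ¬sq | val-outSquare n g₂ i j ¬sq | val-outSquare n g₃ i j ¬sq =
    ℚ.≤-reflexive (solve 1 (λ c → con 0ℚ := con 0ℚ :+ c :* con 0ℚ) refl c)

  nbrSum-affine-≤ : ∀ n g₁ g₂ g₃ c → (∀ i j → InSquare n i j → g₁ i j ≤ g₂ i j + c * g₃ i j) →
                    ∀ i j → nbrSum n g₁ i j ≤ nbrSum n g₂ i j + c * nbrSum n g₃ i j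
  nbrSum-affine-≤ n g₁ g₂ g₃ c g₁≤ i j = begin
    nbrSum n g₁ i j
      ≤⟨ ℚ.+-mono-≤ (ℚ.+-mono-≤ (ℚ.+-mono-≤ (v (suc i) j) (v (i ∸ 1) j)) (v i (suc j))) (v i (j ∸ 1)) ⟩
    ((b (suc i) j + c * d (suc i) j + (b (i ∸ 1) j + c * d (i ∸ 1) j))
      + (b i (suc j) + c * d i (suc j))) + (b i (j ∸ 1) + c * d i (j ∸ 1))
      ≡⟨ solve 9 (λ c b₁ b₂ b₃ b₄ d₁ d₂ d₃ d₄ →
                    ((b₁ :+ c :* d₁ :+ (b₂ :+ c :* d₂)) :+ (b₃ :+ c :* d₃)) :+ (b₄ :+ c :* d₄)
                 := (((b₁ :+ b₂) :+ b₃) :+ b₄) :+ c :* (((d₁ :+ d₂) :+ d₃) :+ d₄))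
           refl c (b (suc i) j) (b (i ∸ 1) j) (b i (suc j)) (b i (j ∸ 1))
                  (d (suc i) j) (d (i ∸ 1) j) (d i (suc j)) (d i (j ∸ 1)) ⟩
    nbrSum n g₂ i j + c * nbrSum n g₃ i j ∎
    where
    open ℚ.≤-Reasoning
    v = val-affine-≤ n g₁ g₂ g₃ c g₁≤
    b = val n g₂
    d = val n g₃

val-0≤ : ∀ n g → (∀ i j → 0ℚ ≤ g i j) → ∀ i j → 0ℚ ≤ val n g i j
val-0≤ n g 0≤g i j with inBox? n i ×-dec inBox? n j
... | yes sq rewrite val-inSquare n g i j sq = 0≤g i j
... | no ¬sq rewrite val-outSquare n g i j ¬sq = ℚ.≤-refl

nbrSum-0≤ : ∀ n g → (∀ i j → 0ℚ ≤ g i j) → ∀ i j → 0ℚ ≤ nbrSum n g i j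
nbrSum-0≤ n g 0≤g i j = ℚ.+-mono-≤ (ℚ.+-mono-≤ (ℚ.+-mono-≤ (v (suc i) j) (v (i ∸ 1) j)) (v i (suc j))) (v i (j ∸ 1))
  where v = val-0≤ n g 0≤g

hitSum : ℕ → ℕ → ℕ → ℕ → ℚ
hitSum n T i j = sumUpTo T (λ t → interleave t (walkProb n i) (walkProb n j))

hitSum-0≤ : ∀ n T i j → 0ℚ ≤ hitSum n T i j
hitSum-0≤ n T i j = sumUpTo-0≤ T (λ t → interleave-0≤ t (walkProb-0≤ n i) (walkProb-0≤ n j))

hitSum-outSquare : ∀ n T i j → 1 ℕ.≤ n → ¬ InSquare n i j → hitSum n T i j ≡ 0ℚ
hitSum-outSquare n T i j 1≤n ¬sq = sumUpTo-zero T vanish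
  where
  vanish : ∀ t → interleave t (walkProb n i) (walkProb n j) ≡ 0ℚ
  vanish t with inBox? n i | inBox? n j
  ... | no ¬bi | _      = interleave-zeroˡ t _ (λ k → walkProb-outBox n i k 1≤n ¬bi)
  ... | yes _  | no ¬bj = interleave-zeroʳ t _ (λ k → walkProb-outBox n j k 1≤n ¬bj)
  ... | yes bi | yes bj = ⊥-elim (¬sq (bi , bj))

module _ where
  open ℚ-Solver

  hitSum-suc : ∀ n T i j → 1 ℕ.≤ n → InSquare n i j →
    hitSum n (suc T) i j ≡ walkProb n i 0 * walkProb n j 0 + (½ * ½) * nbrSum n (hitSum n T) i j
  hitSum-suc n T i j 1≤n (bi , bj) = cong (λ x → walkProb n i 0 * walkProb n j 0 + x) (begin
    sumUpTo T (λ t → ½ * I t pᵢ⁺ pⱼ + ½ * I t pᵢ pⱼ⁺)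
      ≡⟨ sumUpTo-cong T split ⟩
    sumUpTo T (λ t → ½ * (½ * A t + ½ * B t) + ½ * (½ * C t + ½ * D t))
      ≡⟨ sumUpTo-linear T ½ ½ _ _ ⟩
    ½ * sumUpTo T (λ t → ½ * A t + ½ * B t) + ½ * sumUpTo T (λ t → ½ * C t + ½ * D t)
      ≡⟨ cong₂ (λ x y → ½ * x + ½ * y) (sumUpTo-linear T ½ ½ A B) (sumUpTo-linear T ½ ½ C D) ⟩
    ½ * (½ * ΣA + ½ * ΣB) + ½ * (½ * ΣC + ½ * ΣD)
      ≡⟨ solve 4 (λ a b c d → con ½ :* (con ½ :* a :+ con ½ :* b) :+ con ½ :* (con ½ :* c :+ con ½ :* d)
                            := (con ½ :* con ½) :* (((a :+ b) :+ c) :+ d)) refl ΣA ΣB ΣC ΣD ⟩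
    (½ * ½) * (((ΣA + ΣB) + ΣC) + ΣD)
      ≡⟨ cong ((½ * ½) *_) (sym (cong₂ _+_ (cong₂ _+_ (cong₂ _+_ (V (suc i) j) (V (i ∸ 1) j)) (V i (suc j))) (V i (j ∸ 1)))) ⟩
    (½ * ½) * nbrSum n (hitSum n T) i j ∎)
    where
    open ≡-Reasoning
    I = interleave
    pᵢ = walkProb n i
    pⱼ = walkProb n j
    pᵢ⁺ = λ k → pᵢ (suc k)
    pⱼ⁺ = λ k → pⱼ (suc k)
    A = λ t → I t (walkProb n (suc i)) pⱼ
    B = λ t → I t (walkProb n (i ∸ 1)) pⱼ
    C = λ t → I t pᵢ (walkProb n (suc j))
    D = λ t → I t pᵢ (walkProb n (j ∸ 1))
    ΣA = sumUpTo T A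
    ΣB = sumUpTo T B
    ΣC = sumUpTo T C
    ΣD = sumUpTo T D
    split : ∀ t → ½ * I t pᵢ⁺ pⱼ + ½ * I t pᵢ pⱼ⁺ ≡ ½ * (½ * A t + ½ * B t) + ½ * (½ * C t + ½ * D t)
    split t = cong₂ (λ x y → ½ * x + ½ * y)
      (trans (interleave-cong t (λ k → walkProb-suc-inBox n i k bi) (λ _ → refl)) (interleave-linearˡ t ½ ½ _ _ pⱼ))
      (trans (interleave-cong t (λ _ → refl) (λ k → walkProb-suc-inBox n j k bj)) (interleave-linearʳ t ½ ½ pᵢ _ _))
    V : ∀ i j → val n (hitSum n T) i j ≡ hitSum n T i j
    V = val-vanishing n (hitSum n T) (λ i j → hitSum-outSquare n T i j 1≤n)

parabolaProduct : ℕ → ℕ → ℕ → ℚ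
parabolaProduct n i j = fromℕ (parabola n i ℕ.* parabola n j)

parabolaProduct-0≤ : ∀ n i j → 0ℚ ≤ parabolaProduct n i j
parabolaProduct-0≤ n i j = 0≤fromℕ _

parabolaProduct-≥1 : ∀ n i j → InSquare n i j → 1ℚ ≤ parabolaProduct n i j
parabolaProduct-≥1 n i j (bi , bj) = subst (_≤ parabolaProduct n i j) 1/ₙ1≡1
  (fromℕ-mono-≤ (ℕ.*-mono-≤ (parabola-pos n i bi) (parabola-pos n j bj)))

parabolaProduct-outSquare : ∀ n i j → ¬ InSquare n i j → parabolaProduct n i j ≡ 0ℚ
parabolaProduct-outSquare n i j ¬sq = trans (cong fromℕ product≡0) 0/ₙ1≡0
  where
  product≡0 : parabola n i ℕ.* parabola n j ≡ 0
  product≡0 with inBox? n i | inBox? n j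
  ... | no ¬bi | _      = cong (ℕ._* parabola n j) (parabola-outBox n i ¬bi)
  ... | yes _  | no ¬bj = trans (cong (parabola n i ℕ.*_) (parabola-outBox n j ¬bj)) (ℕ.*-zeroʳ (parabola n i))
  ... | yes bi | yes bj = ⊥-elim (¬sq (bi , bj))

module _ where
  open ℕ-Solver

  parabolaProduct-concave : ∀ n i j → InSquare n i j →
    let fᵢ = parabola n i ; fⱼ = parabola n j in
    ((parabola n (suc i) ℕ.* fⱼ ℕ.+ parabola n (i ∸ 1) ℕ.* fⱼ) ℕ.+ fᵢ ℕ.* parabola n (suc j)) ℕ.+ fᵢ ℕ.* parabola n (j ∸ 1)
      ℕ.+ 2 ℕ.* (fᵢ ℕ.+ fⱼ) ≡ 4 ℕ.* (fᵢ ℕ.* fⱼ)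
  parabolaProduct-concave n i j (bi , bj) = begin
    ((a ℕ.* fⱼ ℕ.+ b ℕ.* fⱼ) ℕ.+ fᵢ ℕ.* c) ℕ.+ fᵢ ℕ.* d ℕ.+ 2 ℕ.* (fᵢ ℕ.+ fⱼ)
      ≡⟨ solve 6 (λ a b c d fᵢ fⱼ → ((a :* fⱼ :+ b :* fⱼ) :+ fᵢ :* c) :+ fᵢ :* d :+ con 2 :* (fᵢ :+ fⱼ)
                                  := fⱼ :* (a :+ b :+ con 2) :+ fᵢ :* (c :+ d :+ con 2)) refl a b c d fᵢ fⱼ ⟩
    fⱼ ℕ.* (a ℕ.+ b ℕ.+ 2) ℕ.+ fᵢ ℕ.* (c ℕ.+ d ℕ.+ 2)
      ≡⟨ cong₂ (λ x y → fⱼ ℕ.* x ℕ.+ fᵢ ℕ.* y) (parabola-concave n i bi) (parabola-concave n j bj) ⟩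
    fⱼ ℕ.* (2 ℕ.* fᵢ) ℕ.+ fᵢ ℕ.* (2 ℕ.* fⱼ)
      ≡⟨ solve 2 (λ fᵢ fⱼ → fⱼ :* (con 2 :* fᵢ) :+ fᵢ :* (con 2 :* fⱼ) := con 4 :* (fᵢ :* fⱼ)) refl fᵢ fⱼ ⟩
    4 ℕ.* (fᵢ ℕ.* fⱼ) ∎
    where
    open ≡-Reasoning
    fᵢ = parabola n i
    fⱼ = parabola n j
    a = parabola n (suc i)
    b = parabola n (i ∸ 1)
    c = parabola n (suc j)
    d = parabola n (j ∸ 1)

  parabolaProduct-bound : ∀ n L i j → suc L ≡ 2 ℕ.* (n ℕ.* n) → InSquare n i j →
    4 ℕ.* (parabola n i ℕ.* parabola n j) ℕ.≤ 2 ℕ.* (parabola n i ℕ.+ parabola n j) ℕ.* suc L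
  parabolaProduct-bound n L i j sucL≡2n² (_ , bj) = begin
    4 ℕ.* (fᵢ ℕ.* fⱼ)               ≤⟨ ℕ.*-monoʳ-≤ 4 (ℕ.*-mono-≤ (ℕ.m≤m+n fᵢ fⱼ) (parabola-≤ n j bj)) ⟩
    4 ℕ.* ((fᵢ ℕ.+ fⱼ) ℕ.* (n ℕ.* n)) ≡⟨ solve 2 (λ s m → con 4 :* (s :* m) := con 2 :* s :* (con 2 :* m)) refl (fᵢ ℕ.+ fⱼ) (n ℕ.* n) ⟩
    2 ℕ.* (fᵢ ℕ.+ fⱼ) ℕ.* (2 ℕ.* (n ℕ.* n)) ≡⟨ cong (2 ℕ.* (fᵢ ℕ.+ fⱼ) ℕ.*_) (sym sucL≡2n²) ⟩
    2 ℕ.* (fᵢ ℕ.+ fⱼ) ℕ.* suc L     ∎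
    where
    open ℕ.≤-Reasoning
    fᵢ = parabola n i
    fⱼ = parabola n j

½*½≡1/ₙ4 : ½ * ½ ≡ 1 /ₙ 4
½*½≡1/ₙ4 = trans (cong₂ _*_ ½≡1/ₙ2 ½≡1/ₙ2) (/ₙ-* 1 2 1 2)

parabolaProduct-superharmonic : ∀ n L i j → suc L ≡ 2 ℕ.* (n ℕ.* n) → InSquare n i j →
  (½ * ½) * nbrSum n (parabolaProduct n) i j ≤ ratio L * parabolaProduct n i j
parabolaProduct-superharmonic n L i j sucL≡2n² sq = begin
  (½ * ½) * nbrSum n (parabolaProduct n) i j
    ≡⟨ cong₂ _*_ ½*½≡1/ₙ4 (trans (cong₂ _+_ (cong₂ _+_ (cong₂ _+_ (V (suc i) j) (V (i ∸ 1) j)) (V i (suc j))) (V i (j ∸ 1))) sum≡) ⟩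
  (1 /ₙ 4) * fromℕ S
    ≤⟨ margin⇒ratio S 4 (fᵢ ℕ.* fⱼ) L (superharmonic-margin S 2 (fᵢ ℕ.+ fⱼ) 4 (fᵢ ℕ.* fⱼ) L
         (parabolaProduct-concave n i j sq) (parabolaProduct-bound n L i j sucL≡2n² sq)) ⟩
  ratio L * parabolaProduct n i j ∎
  where
  open ℚ.≤-Reasoning
  fᵢ = parabola n i
  fⱼ = parabola n j
  a = parabola n (suc i) ℕ.* fⱼ
  b = parabola n (i ∸ 1) ℕ.* fⱼ
  c = fᵢ ℕ.* parabola n (suc j)
  d = fᵢ ℕ.* parabola n (j ∸ 1)
  S = ((a ℕ.+ b) ℕ.+ c) ℕ.+ d
  V : ∀ i j → val n (parabolaProduct n) i j ≡ parabolaProduct n i j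
  V = val-vanishing n (parabolaProduct n) (parabolaProduct-outSquare n)
  sum≡ : fromℕ a + fromℕ b + fromℕ c + fromℕ d ≡ fromℕ S
  sum≡ = sym (trans (fromℕ-+ (a ℕ.+ b ℕ.+ c) d)
                    (cong (_+ fromℕ d) (trans (fromℕ-+ (a ℕ.+ b) c) (cong (_+ fromℕ c) (fromℕ-+ a b)))))

-- Comparison with the potential

module _ where
  open ℚ-Solver

  potential-≤ : ∀ n L h B → 1 ℕ.≤ n → suc L ≡ 2 ℕ.* (n ℕ.* n) → IsPotential n n n h →
    0ℚ ≤ B → (∀ i j → i ℕ.≤ n → j ℕ.≤ n → h i j ≤ B) →
    ∀ T i j → InSquare n i j → h i j ≤ hitSum n T i j + (B * ratio L ^ T) * parabolaProduct n i j
  potential-≤ n L h B 1≤n sucL≡2n² (h[n,n]≡1 , harmonic) 0≤B h≤B = go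
    where
    go : ∀ T i j → InSquare n i j → h i j ≤ hitSum n T i j + (B * ratio L ^ T) * parabolaProduct n i j
    go zero i j sq = begin
      h i j                        ≤⟨ h≤B i j (proj₂ (proj₁ sq)) (proj₂ (proj₂ sq)) ⟩
      B                            ≡⟨ sym (ℚ.*-identityʳ B) ⟩
      B * 1ℚ                       ≤⟨ *-monoˡ-≤-0≤ 0≤B (parabolaProduct-≥1 n i j sq) ⟩
      B * parabolaProduct n i j    ≡⟨ solve 2 (λ B ψ → B :* ψ := con 0ℚ :+ (B :* con 1ℚ) :* ψ) refl B (parabolaProduct n i j) ⟩
      0ℚ + (B * 1ℚ) * parabolaProduct n i j ∎
      where open ℚ.≤-Reasoning
    go (suc T) i j sq with (i ℕ.≟ n) ×-dec (j ℕ.≟ n)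
    ... | yes (refl , refl) = begin
      h n n                                   ≡⟨ h[n,n]≡1 ⟩
      1ℚ                                      ≡⟨ sym (trans (cong₂ _*_ p₀≡1 p₀≡1) (ℚ.*-identityˡ 1ℚ)) ⟩
      p₀ * p₀                                 ≤⟨ ≤-+-0≤ (p₀ * p₀) (*-0≤ (*-0≤ 0≤½ 0≤½)
                                                   (nbrSum-0≤ n (hitSum n T) (hitSum-0≤ n T) n n)) ⟩
      p₀ * p₀ + (½ * ½) * nbrSum n (hitSum n T) n n ≡⟨ sym (hitSum-suc n T n n 1≤n sq) ⟩
      hitSum n (suc T) n n                    ≤⟨ ≤-+-0≤ (hitSum n (suc T) n n) (*-0≤ (*-0≤ 0≤B (^-0≤ (0≤ratio L) (suc T)))
                                                   (parabolaProduct-0≤ n n n)) ⟩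
      hitSum n (suc T) n n + (B * ratio L ^ suc T) * parabolaProduct n n n ∎
      where
      open ℚ.≤-Reasoning
      p₀ = walkProb n n 0
      p₀≡1 = walkProb-zero-target n 1≤n
    ... | no ¬target = begin
      h i j                                              ≡⟨ solve 1 (λ x → x := (con ½ :* con ½) :* (con (+ 4 / 1) :* x)) refl (h i j) ⟩
      ¼ * ((+ 4 / 1) * h i j)                            ≡⟨ cong (¼ *_) (harmonic i j (proj₁ sq) (proj₂ sq) ¬target) ⟩
      ¼ * nbrSum n h i j                                 ≤⟨ *-monoˡ-≤-0≤ (*-0≤ 0≤½ 0≤½)
                                                              (nbrSum-affine-≤ n h (hitSum n T) (parabolaProduct n) c (go T) i j) ⟩
      ¼ * (nbrSum n (hitSum n T) i j + c * nbrSum n (parabolaProduct n) i j)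
                                                         ≡⟨ solve 4 (λ q F c Ψ → q :* (F :+ c :* Ψ) := q :* F :+ c :* (q :* Ψ))
                                                              refl ¼ (nbrSum n (hitSum n T) i j) c (nbrSum n (parabolaProduct n) i j) ⟩
      ¼ * nbrSum n (hitSum n T) i j + c * (¼ * nbrSum n (parabolaProduct n) i j)
                                                         ≤⟨ ℚ.+-mono-≤ (≤-0≤-+ (¼ * nbrSum n (hitSum n T) i j)
                                                                           (*-0≤ (walkProb-0≤ n i 0) (walkProb-0≤ n j 0)))
                                                              (*-monoˡ-≤-0≤ 0≤c (parabolaProduct-superharmonic n L i j sucL≡2n² sq)) ⟩
      (walkProb n i 0 * walkProb n j 0 + ¼ * nbrSum n (hitSum n T) i j) + c * (ratio L * parabolaProduct n i j)
                                                         ≡⟨ cong₂ _+_ (sym (hitSum-suc n T i j 1≤n sq))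
                                                              (solve 4 (λ B r ρ ψ → (B :* r) :* (ρ :* ψ) := (B :* (ρ :* r)) :* ψ)
                                                                 refl B (ratio L ^ T) (ratio L) (parabolaProduct n i j)) ⟩
      hitSum n (suc T) i j + (B * ratio L ^ suc T) * parabolaProduct n i j ∎
      where
      open ℚ.≤-Reasoning
      ¼ = ½ * ½
      c = B * ratio L ^ T
      0≤c = *-0≤ 0≤B (^-0≤ (0≤ratio L) T)

hitSum-≤-Psum : ∀ n T t₀ → (∀ t → P n t ≤ P n t₀) → hitSum n T 1 1 ≤ ((+ 2 / 1) * P n t₀) * Psum n T
hitSum-≤-Psum n T t₀ P≤P[t₀] = subst (hitSum n T 1 1 ≤_) (cong ((+ 2 / 1) * P n t₀ *_) sumP≡Psum)
  (sumUpTo-interleave-≤ T (P n t₀) 0≤P[t₀] (walkProb-0≤ n 1)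
    (λ k → subst (_≤ P n t₀) (P≡walkProb n k) (P≤P[t₀] k)))
  where
  0≤P[t₀] = subst (0ℚ ≤_) (sym (P≡walkProb n t₀)) (walkProb-0≤ n 1 t₀)
  sumP≡Psum : sumUpTo T (walkProb n 1) ≡ Psum n T
  sumP≡Psum = sym (trans (Psum≡sumUpTo n T) (sumUpTo-cong T (P≡walkProb n)))

mainTheorem5 : ∀ (n : ℕ) → 20 ≤ℕ n →
    ∀ (h : ℕ → ℕ → ℚ) → IsPotential n n n h →
    Σ ℕ (λ t₀ → (∀ t → P n t ≤ P n t₀) ×
      (∀ (ε : ℚ) → 0ℚ < ε →
        ∃ (λ T → h 1 1 ≤ ((+ 2 / 1) * P n t₀) * Psum n T + ε)))
mainTheorem5 n@(suc _) 20≤n h pot = t₀ , P≤P[t₀] , bound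
  where
  1≤n = s≤s z≤n
  maximum = P-attainsMax n (ℕ.≤-trans (s≤s (s≤s z≤n)) 20≤n)
  t₀ = proj₁ maximum
  P≤P[t₀] = proj₂ maximum
  L = ℕ.pred (2 ℕ.* (n ℕ.* n))
  sucL≡2n² : suc L ≡ 2 ℕ.* (n ℕ.* n)
  sucL≡2n² = refl
  1≤L : 1 ℕ.≤ L
  1≤L = ℕ.≤-pred (ℕ.*-monoʳ-≤ 2 (ℕ.*-mono-≤ 1≤n 1≤n))
  square = boundedOnSquare h n
  B = proj₁ square
  ψ₁₁ = parabolaProduct n 1 1
  sq₁₁ : InSquare n 1 1
  sq₁₁ = (ℕ.≤-refl , 1≤n) , (ℕ.≤-refl , 1≤n)
  bound : ∀ ε → 0ℚ < ε → ∃ λ T → h 1 1 ≤ ((+ 2 / 1) * P n t₀) * Psum n T + ε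
  bound ε 0<ε with T , error≤ε ← ratio^-eventually-≤ L (B * ψ₁₁) ε 1≤L 0<ε = T , (begin
    h 1 1                                    ≤⟨ potential-≤ n L h B 1≤n sucL≡2n² pot (proj₁ (proj₂ square))
                                                  (proj₂ (proj₂ square)) T 1 1 sq₁₁ ⟩
    hitSum n T 1 1 + (B * ratio L ^ T) * ψ₁₁ ≤⟨ ℚ.+-mono-≤ (hitSum-≤-Psum n T t₀ P≤P[t₀])
                                                  (subst (_≤ ε) (*-swapʳ B ψ₁₁ (ratio L ^ T)) error≤ε) ⟩
    ((+ 2 / 1) * P n t₀) * Psum n T + ε      ∎)
    where open ℚ.≤-Reasoning
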